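{- $\vec\chi(Forb_{ind}(\overleftrightarrow{K_2}, K_3, P^+(3)))=2$; that is, every oriented graph whose underlying graph is triangle-free and which has no induced directed path with $3$ arcs has dichromatic number at most $2$, and $2$ is attained.
   Context: Digraphs have no loops and no parallel arcs, but both $xy$ and $yx$ may be arcs. The dichromatic number $\vec\chi(D)$ is the minimum number of colors in a vertex coloring in which no color class induces a directed cycle; $\vec\chi(\mathcal C)=\sup_{D\in\mathcal C}\vec\chi(D)$. For a set $\mathcal F$ of digraphs and undirected graphs, $Forb_{ind}(\mathcal F)$ is the class of digraphs containing as an induced subdigraph neither a digraph in $\mathcal F$ nor any orientation of an undirected graph in $\mathcal F$. $\overleftrightarrow{K_2}$ is the digon; $K_3$ is the undirected triangle (so all its orientations are forbidden); $P^+(3)$ is the directed path with $3$ arcs. -}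

module Defs where

open import Data.Nat using (ℕ; suc)
open import Data.Fin using (Fin; zero; suc; inject₁; fromℕ)
open import Data.Bool using (Bool; true; false)
open import Data.Product using (Σ; _×_; ∃)
open import Relation.Binary.PropositionalEquality using (_≡_; _≢_)
open import Relation.Nullary using (¬_)
open import Function.Definitions using (Injective)

-- A finite digraph on vertex set Fin n: arc relation as a Bool matrix,
-- with no loops. (No parallel arcs is automatic; both xy and yx allowed.)
record Digraph (n : ℕ) : Set where
  field
    arc    : Fin n → Fin n → Bool
    noLoop : ∀ v → arc v v ≡ false
open Digraph public

Arc : ∀ {n} → Digraph n → Fin n → Fin n → Set
Arc D x y = arc D x y ≡ true

NoArc : ∀ {n} → Digraph n → Fin n → Fin n → Set
NoArc D x y = arc D x y ≡ false

OneWay : ∀ {n} → Digraph n → Fin n → Fin n → Set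
OneWay D x y = Arc D x y × NoArc D y x

data Single {n} (D : Digraph n) (x y : Fin n) : Set where
  fwd : OneWay D x y → Single D x y
  bwd : OneWay D y x → Single D x y

HasInducedDigon : ∀ {n} → Digraph n → Set
HasInducedDigon {n} D = Σ (Fin n) λ x → Σ (Fin n) λ y → Arc D x y × Arc D y x

HasInducedOrientedK3 : ∀ {n} → Digraph n → Set
HasInducedOrientedK3 {n} D =
  Σ (Fin n) λ a → Σ (Fin n) λ b → Σ (Fin n) λ c →
    (a ≢ b) × (b ≢ c) × (a ≢ c) ×
    Single D a b × Single D b c × Single D a c

HasInducedP3 : ∀ {n} → Digraph n → Set
HasInducedP3 {n} D =
  Σ (Fin n) λ a → Σ (Fin n) λ b → Σ (Fin n) λ c → Σ (Fin n) λ d →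
    (a ≢ b) × (a ≢ c) × (a ≢ d) × (b ≢ c) × (b ≢ d) × (c ≢ d) ×
    OneWay D a b × OneWay D b c × OneWay D c d ×
    NoArc D a c × NoArc D c a × NoArc D a d × NoArc D d a ×
    NoArc D b d × NoArc D d b

InClass : ∀ {n} → Digraph n → Set
InClass D = ¬ HasInducedDigon D × ¬ HasInducedOrientedK3 D × ¬ HasInducedP3 D

-- directed cycle of length m+2: distinct vertices cyc 0, …, cyc (m+1) with
-- arcs cyc i → cyc (i+1) and cyc (m+1) → cyc 0
record DirCycle {n} (D : Digraph n) (m : ℕ) : Set where
  field
    cyc   : Fin (suc (suc m)) → Fin n
    inj   : Injective _≡_ _≡_ cyc
    steps : ∀ (i : Fin (suc m)) → Arc D (cyc (inject₁ i)) (cyc (suc i))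
    close : Arc D (cyc (fromℕ (suc m))) (cyc zero)
open DirCycle public

-- a k-colouring in which no colour class induces a directed cycle
-- (equivalently: no directed cycle is monochromatic, since the induced
-- subdigraph on a colour class keeps all arcs among its vertices)
AcyclicColouring : ∀ {n} → Digraph n → (k : ℕ) → (Fin n → Fin k) → Set
AcyclicColouring {n} D k col =
  ∀ (m : ℕ) (C : DirCycle D m) (c : Fin k) →
    ¬ (∀ i → col (cyc C i) ≡ c)

DichromaticAtMost : ∀ {n} → Digraph n → ℕ → Set
DichromaticAtMost {n} D k = Σ (Fin n → Fin k) λ col → AcyclicColouring D k col

-- Forbidding induced P⁺(3) and triangles forces the two ends of every directed walk of odd
-- length to be adjacent (induction, peeling two arcs off each end). Colour each vertex by whether
-- it is adjacent to a fixed root r of its strong component. An arc x → y inside the component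
-- cannot have both ends adjacent to r (a triangle), nor neither: one of the walks r ⋯ x, y ⋯ r
-- or the closed walk r ⋯ x → y ⋯ r has odd length, and r is not adjacent to itself. So no
-- directed cycle is monochromatic. The directed 4-cycle needs two colours.
module Submission where

open import Defs
open import Data.Nat using (ℕ; zero; suc; _+_; _*_; _≤_; _<_; s≤s; _≤?_)
open import Data.Nat.Properties using (+-suc; *-distribʳ-+; ≰⇒>; m≤n⇒m≤1+n; m<n⇒m<1+n; ≤-refl)
open import Data.Nat.Induction using (<-wellFounded)
open import Induction.WellFounded using (Acc; acc)
open import Data.Fin using (Fin; zero; suc; toℕ; fromℕ<; inject₁; fromℕ)
open import Data.Fin.Patterns using (0F; 1F; 2F; 3F)
open import Data.Fin.Properties using (_≟_; any?; pigeonhole; toℕ-fromℕ<)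
import Data.Bool.Properties as Bool
open import Data.Bool using (Bool; true; false)
open import Data.Maybe using (Maybe; just; nothing; maybe′)
import Data.Maybe as Maybe
open import Data.Product using (Σ; ∃; _×_; _,_)
open import Data.Sum using (_⊎_; inj₁; inj₂; [_,_]; swap)
open import Data.Empty using (⊥-elim)
open import Function using (_∘_)
open import Relation.Unary using (Pred; Decidable)
open import Relation.Nullary using (¬_; Dec; yes; no; contradiction)
open import Relation.Nullary.Decidable using (map′; _×-dec_; _⊎-dec_; ¬?; toWitness)
open import Relation.Binary.PropositionalEquality using (_≡_; _≢_; refl; sym; trans; cong; subst)

first : ∀ {k p} {P : Pred (Fin k) p} → Decidable P → Maybe (Fin k)
first {zero}  P? = nothing
first {suc k} P? with P? zero
... | yes _ = just zero
... | no _  = Maybe.map suc (first (P? ∘ suc))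

first-cong : ∀ {k p q} {P : Pred (Fin k) p} {Q : Pred (Fin k) q} (P? : Decidable P) (Q? : Decidable Q) →
             (∀ {i} → P i → Q i) → (∀ {i} → Q i → P i) → first P? ≡ first Q?
first-cong {zero}  P? Q? P⇒Q Q⇒P = refl
first-cong {suc k} P? Q? P⇒Q Q⇒P with P? zero | Q? zero
... | yes _  | yes _  = refl
... | yes P₀ | no ¬Q₀ = contradiction (P⇒Q P₀) ¬Q₀
... | no ¬P₀ | yes Q₀ = contradiction (Q⇒P Q₀) ¬P₀
... | no _   | no _   = cong (Maybe.map suc) (first-cong (P? ∘ suc) (Q? ∘ suc) P⇒Q Q⇒P)

first-just : ∀ {k p} {P : Pred (Fin k) p} (P? : Decidable P) {z} → P z → ∃ λ r → first P? ≡ just r × P r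
first-just {suc k} P? {zero} Pz with P? zero
... | yes P₀ = zero , refl , P₀
... | no ¬P₀ = contradiction Pz ¬P₀
first-just {suc k} P? {suc z} Pz with P? zero
... | yes P₀ = zero , refl , P₀
... | no _ with r , found , Pr ← first-just (P? ∘ suc) Pz = suc r , cong (Maybe.map suc) found , Pr

data Parity : ℕ → Set where
  even : ∀ k → Parity (k * 2)
  odd  : ∀ k → Parity (suc (k * 2))

parity : ∀ n → Parity n
parity zero = even 0
parity (suc n) with parity n
... | even k = odd k
... | odd k  = even (suc k)

side : ∀ {p} {P : Set p} → Dec P → Fin 2
side (yes _) = 1F
side (no _)  = 0F

side-≢ : ∀ {p q} {P : Set p} {Q : Set q} → (P → ¬ Q) → (¬ P → Q) → (P? : Dec P) (Q? : Dec Q) → side P? ≢ side Q?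
side-≢ P⇒¬Q ¬P⇒Q (yes P₀) (yes Q₀) _  = P⇒¬Q P₀ Q₀
side-≢ P⇒¬Q ¬P⇒Q (no ¬P₀) (no ¬Q₀) _  = ¬Q₀ (¬P⇒Q ¬P₀)
side-≢ P⇒¬Q ¬P⇒Q (yes _)  (no _)   ()
side-≢ P⇒¬Q ¬P⇒Q (no _)   (yes _)  ()

module Walks {n} (D : Digraph n) where

  Adjacent : Fin n → Fin n → Set
  Adjacent x y = Arc D x y ⊎ Arc D y x

  adjacent? : ∀ x y → Dec (Adjacent x y)
  adjacent? x y = (arc D x y Bool.≟ true) ⊎-dec (arc D y x Bool.≟ true)

  arc⇒≢ : ∀ {x y} → Arc D x y → x ≢ y
  arc⇒≢ {x} xy refl with () ← trans (sym xy) (noLoop D x)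

  adjacent⇒≢ : ∀ {x y} → Adjacent x y → x ≢ y
  adjacent⇒≢ (inj₁ xy) = arc⇒≢ xy
  adjacent⇒≢ (inj₂ yx) = arc⇒≢ yx ∘ sym

  ¬adjacent⇒noArcs : ∀ {x y} → ¬ Adjacent x y → NoArc D x y × NoArc D y x
  ¬adjacent⇒noArcs ¬xy = Bool.¬-not (¬xy ∘ inj₁) , Bool.¬-not (¬xy ∘ inj₂)

  infixr 5 _∷_ _++_
  infixl 5 _∷ʳ_

  data Walk : Fin n → Fin n → ℕ → Set where
    []  : ∀ {x} → Walk x x 0
    _∷_ : ∀ {x y z L} → Arc D x y → Walk y z L → Walk x z (suc L)

  _∷ʳ_ : ∀ {x y z L} → Walk x y L → Arc D y z → Walk x z (suc L)
  []       ∷ʳ yz = yz ∷ []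
  (xw ∷ w) ∷ʳ yz = xw ∷ (w ∷ʳ yz)

  _++_ : ∀ {x y z L M} → Walk x y L → Walk y z M → Walk x z (L + M)
  []       ++ v = v
  (xw ∷ w) ++ v = xw ∷ (w ++ v)

  unsnoc : ∀ {x z L} → Walk x z (suc L) → ∃ λ y → Walk x y L × Arc D y z
  unsnoc (xz ∷ []) = _ , [] , xz
  unsnoc (xw ∷ w@(_ ∷ _)) with y , w′ , yz ← unsnoc w = y , xw ∷ w′ , yz

  walkAlong : ∀ {k} (f : Fin (suc k) → Fin n) → (∀ i → Arc D (f (inject₁ i)) (f (suc i))) →
              Walk (f zero) (f (fromℕ k)) k
  walkAlong {zero}  f steps = []
  walkAlong {suc k} f steps = steps zero ∷ walkAlong (f ∘ suc) (steps ∘ suc)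

  vertex : ∀ {x y L} → Walk x y L → Fin (suc L) → Fin n
  vertex {x} w        zero    = x
  vertex     (_ ∷ w) (suc i) = vertex w i

  suffix : ∀ {x y L} (w : Walk x y (suc L)) (j : Fin (suc L)) → ∃ λ M → M ≤ L × Walk (vertex w (suc j)) y M
  suffix {L = L} (_ ∷ w) zero = L , ≤-refl , w
  suffix (_ ∷ w@(_ ∷ _)) (suc j) with M , M≤L , w′ ← suffix w j = M , m≤n⇒m≤1+n M≤L , w′

  shortcut : ∀ {x y L} (w : Walk x y L) (i j : Fin (suc L)) → toℕ i < toℕ j → vertex w i ≡ vertex w j →
             ∃ λ M → M < L × Walk x y M
  shortcut {y = y} w@(_ ∷ _) zero (suc j) _ loop with M , M≤L , w′ ← suffix w j =
    M , s≤s M≤L , subst (λ v → Walk v y M) (sym loop) w′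
  shortcut (xw ∷ w) (suc i) (suc j) (s≤s i<j) loop with M , M<L , w′ ← shortcut w i j i<j loop =
    suc M , s≤s M<L , xw ∷ w′

  shorten : ∀ {x y L} → Acc _<_ L → Walk x y L → ∃ λ M → M ≤ n × Walk x y M
  shorten {L = L} (acc rec) w with L ≤? n
  ... | yes L≤n = L , L≤n , w
  ... | no L≰n
    with i , j , i<j , loop ← pigeonhole (m<n⇒m<1+n (≰⇒> L≰n)) (vertex w)
    with M , M<L , w′ ← shortcut w i j i<j loop = shorten (rec M<L) w′

  walk? : ∀ L x y → Dec (Walk x y L)
  walk? zero x y = map′ (λ { refl → [] }) (λ { [] → refl }) (x ≟ y)
  walk? (suc L) x y =
    map′ (λ (z , xz , w) → xz ∷ w) (λ { (xz ∷ w) → _ , xz , w })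
         (any? λ z → (arc D x z Bool.≟ true) ×-dec walk? L z y)

  Reach : Fin n → Fin n → Set
  Reach x y = ∃ (Walk x y)

  Reach-refl : ∀ {x} → Reach x x
  Reach-refl = 0 , []

  Reach-trans : ∀ {x y z} → Reach x y → Reach y z → Reach x z
  Reach-trans (L , w) (M , v) = L + M , w ++ v

  reach? : ∀ x y → Dec (Reach x y)
  reach? x y = map′ (λ (L , w) → toℕ L , w) fromShort (any? λ (L : Fin (suc n)) → walk? (toℕ L) x y)
    where
    fromShort : Reach x y → ∃ λ (L : Fin (suc n)) → Walk x y (toℕ L)
    fromShort (L , w) with M , M≤n , w′ ← shorten (<-wellFounded L) w =
      fromℕ< (s≤s M≤n) , subst (Walk x y) (sym (toℕ-fromℕ< (s≤s M≤n))) w′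

  Mutual : Fin n → Fin n → Set
  Mutual x y = Reach x y × Reach y x

  mutual? : ∀ x → Decidable (Mutual x)
  mutual? x y = reach? x y ×-dec reach? y x

module _ {n} {D : Digraph n} (noDigon : ¬ HasInducedDigon D) where
  open Walks D

  arc⇒oneWay : ∀ {x y} → Arc D x y → OneWay D x y
  arc⇒oneWay {x} {y} xy = xy , Bool.¬-not λ yx → noDigon (x , y , xy , yx)

  adjacent⇒single : ∀ {x y} → Adjacent x y → Single D x y
  adjacent⇒single (inj₁ xy) = fwd (arc⇒oneWay xy)
  adjacent⇒single (inj₂ yx) = bwd (arc⇒oneWay yx)

  path₂⇒≢ : ∀ {a b c} → Arc D a b → Arc D b c → a ≢ c
  path₂⇒≢ ab bc refl = noDigon (_ , _ , ab , bc)

  module _ (noK3 : ¬ HasInducedOrientedK3 D) where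

    triangle-free : ∀ {u w v} → Arc D u w → Adjacent w v → ¬ Adjacent u v
    triangle-free uw wv uv =
      noK3 (_ , _ , _ , arc⇒≢ uw , adjacent⇒≢ wv , adjacent⇒≢ uv ,
            fwd (arc⇒oneWay uw) , adjacent⇒single wv , adjacent⇒single uv)

    path₂⇒¬adjacent : ∀ {a b c} → Arc D a b → Arc D b c → ¬ Adjacent a c
    path₂⇒¬adjacent ab bc = triangle-free ab (inj₁ bc)

    module _ (noP3 : ¬ HasInducedP3 D) where

      path₃⇒adjacent : ∀ {a b c d} → Arc D a b → Arc D b c → Arc D c d → Adjacent a d
      path₃⇒adjacent {a} {b} {c} {d} ab bc cd with adjacent? a d
      ... | yes ad = ad
      ... | no ¬ad =
        let ac , ca = ¬adjacent⇒noArcs (path₂⇒¬adjacent ab bc)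
            ad , da = ¬adjacent⇒noArcs ¬ad
            bd , db = ¬adjacent⇒noArcs (path₂⇒¬adjacent bc cd)
        in ⊥-elim (noP3 (a , b , c , d , arc⇒≢ ab , path₂⇒≢ ab bc , a≢d , arc⇒≢ bc , path₂⇒≢ bc cd , arc⇒≢ cd ,
                 arc⇒oneWay ab , arc⇒oneWay bc , arc⇒oneWay cd , ac , ca , ad , da , bd , db))
        where
        a≢d : a ≢ d
        a≢d a≡d = path₂⇒¬adjacent ab bc (inj₂ (subst (Arc D c) (sym a≡d) cd))

      -- For u → w₁ → w₂ ⋯ a → b → v: if u → a or w₂ → v, a P⁺(3) closes up; otherwise
      -- v → w₂ ⋯ a → u is a shorter odd walk.
      oddWalk-step : ∀ k → (∀ {x y} → Walk x y (suc (suc k * 2)) → Adjacent x y) →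
                     ∀ {x y} → Walk x y (suc (suc (suc k) * 2)) → Adjacent x y
      oddWalk-step k ih (uw₁ ∷ w₁w₂ ∷ w)
        with b , w″ , bv ← unsnoc w
        with a , w′ , ab ← unsnoc w″
        with ih (uw₁ ∷ w₁w₂ ∷ w′)
      ... | inj₁ ua = path₃⇒adjacent ua ab bv
      ... | inj₂ au with ih (w′ ∷ʳ ab ∷ʳ bv)
      ...   | inj₁ w₂v = path₃⇒adjacent uw₁ w₁w₂ w₂v
      ...   | inj₂ vw₂ = swap (ih (vw₂ ∷ (w′ ∷ʳ au)))

      oddWalk⇒adjacent : ∀ k {x y} → Walk x y (suc (k * 2)) → Adjacent x y
      oddWalk⇒adjacent zero          (xy ∷ [])          = inj₁ xy
      oddWalk⇒adjacent (suc zero)    (ab ∷ bc ∷ cd ∷ []) = path₃⇒adjacent ab bc cd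
      oddWalk⇒adjacent (suc (suc k)) w                  = oddWalk-step k (oddWalk⇒adjacent (suc k)) w

      nonadjacent⇒successor-adjacent : ∀ {r x y} → Arc D x y → Reach r x → Reach y r → ¬ Adjacent x r → Adjacent y r
      nonadjacent⇒successor-adjacent {r} xy (L₁ , rx) (L₂ , yr) ¬xr with parity L₁ | parity L₂
      ... | odd k | _ = contradiction (swap (oddWalk⇒adjacent k rx)) ¬xr
      ... | _ | odd k = oddWalk⇒adjacent k yr
      ... | even k₁ | even k₂ =
        contradiction refl (adjacent⇒≢ (oddWalk⇒adjacent (k₁ + k₂) (subst (Walk r r) oddLength (rx ++ xy ∷ yr))))
        where
        oddLength : k₁ * 2 + suc (k₂ * 2) ≡ suc ((k₁ + k₂) * 2)
        oddLength = trans (+-suc (k₁ * 2) (k₂ * 2)) (cong suc (sym (*-distribʳ-+ 2 k₁ k₂)))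

      -- The root of x is the least vertex of its strong component.
      colour : Fin n → Fin 2
      colour x = maybe′ (λ r → side (adjacent? x r)) 0F (first (mutual? x))

      arc-colours-differ : ∀ {x y} → Arc D x y → Reach y x → colour x ≢ colour y
      arc-colours-differ {x} {y} xy yx
        with r , rootˣ , (xr , rx) ← first-just (mutual? x) (Reach-refl , Reach-refl) = λ same →
          side-≢ (λ x~r y~r → triangle-free xy y~r x~r)
                 (nonadjacent⇒successor-adjacent xy rx (Reach-trans yx xr))
                 (adjacent? x r) (adjacent? y r)
                 (trans (sym (cong (maybe′ _ 0F) rootˣ)) (trans same (cong (maybe′ _ 0F) rootʸ)))
        where
        x⇄y : Reach x y
        x⇄y = 1 , xy ∷ []
        rootʸ : first (mutual? y) ≡ just r
        rootʸ = trans (sym (first-cong (mutual? x) (mutual? y)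
                             (λ (xz , zx) → Reach-trans yx xz , Reach-trans zx x⇄y)
                             (λ (yz , zy) → Reach-trans x⇄y yz , Reach-trans zy yx)))
                      rootˣ

module _ {n} {D : Digraph n} where
  open Walks D

  cycle-returns : ∀ {m} (C : DirCycle D m) → Reach (cyc C 1F) (cyc C 0F)
  cycle-returns {m} C = suc m , walkAlong (cyc C ∘ suc) (steps C ∘ suc) ∷ʳ close C

  inClass⇒dichromatic≤2 : InClass D → DichromaticAtMost D 2
  inClass⇒dichromatic≤2 (noDigon , noK3 , noP3) = colour noDigon noK3 noP3 , acyclic
    where
    acyclic : AcyclicColouring D 2 (colour noDigon noK3 noP3)
    acyclic m C c monochromatic =
      arc-colours-differ noDigon noK3 noP3 (steps C 0F) (cycle-returns C)
        (trans (monochromatic 0F) (sym (monochromatic 1F)))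

  cycle⇒¬dichromatic≤1 : ∀ {m} → DirCycle D m → ¬ DichromaticAtMost D 1
  cycle⇒¬dichromatic≤1 {m} C (col , acyclic) = acyclic m C 0F (λ i → only (col (cyc C i)))
    where
    only : (c : Fin 1) → c ≡ 0F
    only 0F = refl

module _ {n} (D : Digraph n) where

  private
    arc? : ∀ x y → Dec (Arc D x y)
    arc? x y = arc D x y Bool.≟ true

    noArc? : ∀ x y → Dec (NoArc D x y)
    noArc? x y = arc D x y Bool.≟ false

    oneWay? : ∀ x y → Dec (OneWay D x y)
    oneWay? x y = arc? x y ×-dec noArc? y x

    single? : ∀ x y → Dec (Single D x y)
    single? x y = map′ [ fwd , bwd ] (λ { (fwd xy) → inj₁ xy ; (bwd yx) → inj₂ yx })
                       (oneWay? x y ⊎-dec oneWay? y x)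

    _≢?_ : ∀ (x y : Fin n) → Dec (x ≢ y)
    x ≢? y = ¬? (x ≟ y)

  inducedDigon? : Dec (HasInducedDigon D)
  inducedDigon? = any? λ x → any? λ y → arc? x y ×-dec arc? y x

  inducedOrientedK3? : Dec (HasInducedOrientedK3 D)
  inducedOrientedK3? = any? λ a → any? λ b → any? λ c →
    a ≢? b ×-dec b ≢? c ×-dec a ≢? c ×-dec single? a b ×-dec single? b c ×-dec single? a c

  inducedP3? : Dec (HasInducedP3 D)
  inducedP3? = any? λ a → any? λ b → any? λ c → any? λ d →
    a ≢? b ×-dec a ≢? c ×-dec a ≢? d ×-dec b ≢? c ×-dec b ≢? d ×-dec c ≢? d ×-dec
    oneWay? a b ×-dec oneWay? b c ×-dec oneWay? c d ×-dec
    noArc? a c ×-dec noArc? c a ×-dec noArc? a d ×-dec noArc? d a ×-dec noArc? b d ×-dec noArc? d b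

  inClass? : Dec (InClass D)
  inClass? = ¬? inducedDigon? ×-dec ¬? inducedOrientedK3? ×-dec ¬? inducedP3?

directedC4 : Digraph 4
directedC4 = record { arc = next ; noLoop = λ { 0F → refl ; 1F → refl ; 2F → refl ; 3F → refl } }
  where
  next : Fin 4 → Fin 4 → Bool
  next 0F 1F = true
  next 1F 2F = true
  next 2F 3F = true
  next 3F 0F = true
  next _  _  = false

directedC4-cycle : DirCycle directedC4 2
directedC4-cycle = record
  { cyc   = λ i → i
  ; inj   = λ same → same
  ; steps = λ { 0F → refl ; 1F → refl ; 2F → refl }
  ; close = refl
  }

theorem10 : ((n : ℕ) (D : Digraph n) → InClass D → DichromaticAtMost D 2)
            × Σ ℕ (λ n → Σ (Digraph n) (λ D → InClass D × ¬ DichromaticAtMost D 1))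
theorem10 = (λ n D → inClass⇒dichromatic≤2)
          , 4 , directedC4 , toWitness {a? = inClass? directedC4} _ , cycle⇒¬dichromatic≤1 directedC4-cycle
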